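{- Let $m,n$ be positive integers and let ${\sf p}\in\mathcal{PW}_m^n$ have no touch point. Then the action of ${\sf p}$ on $V^m$ has a fixed point.
   Context: $[m]=\{0,\ldots,m-1\}$; $\mathcal{PW}_m^n$ is the set of ${\sf p}={\sf p}_0\cdots{\sf p}_{n-1}\in[m]^n$ with $|\{j:{\sf p}_j<i\}|\ge in/m$ for $1\le i\le m$. For ${\sf p}\in\mathcal{PW}_m^n$, an integer $1\le i<m$ is a touch point of ${\sf p}$ if $|\{j:{\sf p}_j<i\}|=in/m$. $V^m=\{\mathbf{x}\in\mathbb{R}^m:\sum_ix_i=0,\ x_0\le\cdots\le x_{m-1}\}$. A letter $i$ acts on $\mathbf{x}\in V^m$ by $\mathrm{sort}(\mathbf{x}+m\mathbf{e}_i-\mathbb{1}_m)$ (add $m$ to $x_i$, subtract $1$ from all coordinates, sort increasingly); words act letter by letter from left to right. -}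

module Defs where

open import Data.Nat as ℕ using (ℕ; zero; suc; _≤_; _<_)
open import Data.Fin using (Fin; toℕ)
open import Data.Vec using (Vec; []; _∷_)
open import Data.List using (List; []; _∷_; map; foldr; length)
open import Data.Rational as ℚ using (ℚ; 0ℚ; 1ℚ; _+_; _-_)
open import Data.Rational.Properties using (≤-decTotalOrder)
open import Data.List.Sort ≤-decTotalOrder using (sort)
open import Relation.Binary.Bundles using (DecTotalOrder)
open import Data.List.Relation.Unary.Sorted.TotalOrder (DecTotalOrder.totalOrder ≤-decTotalOrder) using (Sorted)
open import Data.Integer using (+_)
open import Relation.Nullary using (yes; no)
open import Data.Product using (_×_)
open import Relation.Binary.PropositionalEquality using (_≡_)
open import Relation.Nullary using (¬_)

countBelow : ∀ {m n} → ℕ → Vec (Fin m) n → ℕ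
countBelow i [] = 0
countBelow i (a ∷ p) with toℕ a ℕ.<? i
... | yes _ = suc (countBelow i p)
... | no _ = countBelow i p

IsPW : (m n : ℕ) → Vec (Fin m) n → Set
IsPW m n p = ∀ i → 1 ≤ i → i ≤ m → i ℕ.* n ≤ m ℕ.* countBelow i p

IsTouchPoint : (m n : ℕ) → Vec (Fin m) n → ℕ → Set
IsTouchPoint m n p i = 1 ≤ i × i < m × m ℕ.* countBelow i p ≡ i ℕ.* n

HasNoTouchPoint : (m n : ℕ) → Vec (Fin m) n → Set
HasNoTouchPoint m n p = ∀ i → ¬ IsTouchPoint m n p i

-- vectors in ℚ^m are represented as lists of length m
sumℚ : List ℚ → ℚ
sumℚ = foldr _+_ 0ℚ

InV : (m : ℕ) → List ℚ → Set
InV m x = length x ≡ m × sumℚ x ≡ 0ℚ × Sorted x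

addAt : ℕ → ℚ → List ℚ → List ℚ
addAt i c [] = []
addAt zero c (y ∷ ys) = (y + c) ∷ ys
addAt (suc i) c (y ∷ ys) = y ∷ addAt i c ys

actLetter : (m : ℕ) → Fin m → List ℚ → List ℚ
actLetter m i x = sort (addAt (toℕ i) (+ m ℚ./ 1) (map (λ y → y - 1ℚ) x))

actWord : ∀ {m n} → Vec (Fin m) n → List ℚ → List ℚ
actWord {m} [] x = x
actWord {m} (a ∷ p) x = actWord p (actLetter m a x)

module Submission where

open import Defs
open import Data.Nat using (ℕ; _≤_)
open import Data.Fin using (Fin)
open import Data.Vec using (Vec)
open import Data.List using (List)
open import Data.Rational using (ℚ)
open import Data.Product using (Σ; _×_)
open import Relation.Binary.PropositionalEquality using (_≡_)

open import Data.Nat.Properties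
open import Algebra.Properties.CommutativeSemigroup +-commutativeSemigroup using (xy∙z≈xz∙y; x∙yz≈y∙xz; interchange)
open import Data.Bool.Base using (true; false)
open import Data.Empty using (⊥-elim)
open import Data.Fin using (toℕ)
open import Data.Fin.Properties using (toℕ<n)
import Data.Integer as ℤ
import Data.Integer.Properties as ℤ
open import Data.List.Base using ([]; _∷_; [_]; _∷ʳ_; map; length; replicate)
open import Data.List.Properties using (length-map; map-∘; map-cong)
open import Data.List.Relation.Binary.Permutation.Propositional using (_↭_; ↭-sym; ↭-trans; ↭-reflexive; ↭⇒↭ₛ)
import Data.List.Relation.Binary.Permutation.Propositional.Properties as ↭
open import Data.List.Relation.Binary.Pointwise using (Pointwise; []; _∷_; Pointwise-≡⇒≡)
open import Data.List.Relation.Unary.All as All using (All; []; _∷_)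
import Data.List.Relation.Unary.All.Properties as All
open import Data.List.Relation.Unary.Linked using ([]; [-]; _∷_)
open import Data.List.Relation.Unary.Sorted.TotalOrder ≤-totalOrder using (Sorted)
import Data.List.Relation.Unary.Sorted.TotalOrder.Properties as Sorted
open import Data.List.Relation.Unary.Sorted.TotalOrder using () renaming (Sorted to SortedBy)
open import Data.List.Sort.InsertionSort ≤-decTotalOrder using (insert; sort)
open import Data.List.Sort.InsertionSort.Properties ≤-decTotalOrder using (sort-↭; sort-↗)
open import Data.Nat using (zero; suc; _+_; _*_; _∸_; _<_; _≟_; _≤?_; _<?_; _≤ᵇ_; z≤n; s≤s; s≤s⁻¹)
import Data.Nat.Coprimality as Coprime
open import Data.Nat.DivMod
  using (_/_; _%_; m<n⇒m/n≡0; m/n≡0⇒m<n; m/n≡1+[m∸n]/n; /-monoˡ-≤; m≡m%n+[m/n]*n; m%n<n; m/n*n≤m; m<n*o⇒m/o<n)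
open import Data.Nat.ListAction using (sum)
open import Data.Nat.ListAction.Properties using (sum-↭)
open import Data.Nat.Tactic.RingSolver using (solve-∀)
open import Data.Product using (_,_; proj₁; proj₂; ∃-syntax)
open import Data.Rational as ℚ using (mkℚ; 0ℚ; 1ℚ; 1/_)
  renaming (_+_ to _+ℚ_; _-_ to _-ℚ_; _*_ to _*ℚ_; _≤_ to _≤ℚ_)
import Data.Rational.Properties as ℚ
import Data.List.Sort ℚ.≤-decTotalOrder as ℚSort
open import Data.Rational.Solver using (module +-*-Solver)
open +-*-Solver using (solve; _:+_; _:-_; _:*_; con; _:=_)
open import Data.Sum using (inj₁; inj₂)
open import Data.Vec using ([]; _∷_)
open import Function.Base using (_∘_)
open import Level using (0ℓ)
open import Relation.Binary.Bundles using (TotalOrder; DecTotalOrder)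
open import Relation.Binary.Definitions using (tri<; tri≈; tri>)
open import Relation.Binary.PropositionalEquality using (refl; sym; trans; cong; cong₂; subst; subst₂; module ≡-Reasoning)
open import Relation.Nullary using (yes; no; ofⁿ)

-- Integer points of V^m are preserved by the action, so work with a sorted list Y
-- of m natural numbers ("chips"): after t letters the chip at height y stands for
-- the coordinate y − t − c, and the letter a lifts the a-th lowest chip by m (hop).
-- A fixed point is then a configuration with run p Y = Y + n.  Configurations are
-- compared through excess k Y = Σ_y ⌊(y − k)/m⌋ (chips y ≥ k).  In this order a
-- hop is monotone in the configuration and in the letter, and two letters applied
-- in increasing order give the larger result; so sorting a word and raising its
-- letters can only increase its effect.  The progression B, B+1, … is moved by
-- exactly n by the word 0ⁿ, which lies below p, and the progression B, B+n, … is
-- moved by exactly n by the staircase word ⌊tm/n⌋, which lies above the sorted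
-- parking word p.  Hence Y ↦ run p Y − n is monotone, starts upwards at the first
-- progression and stays below the second; its iterates increase and are bounded,
-- so they stall, and a stall is a fixed point.

sorted⇒head≤ : ∀ {x xs} → Sorted (x ∷ xs) → All (x ≤_) xs
sorted⇒head≤ [-] = []
sorted⇒head≤ (x≤y ∷ s) = x≤y ∷ All.map (≤-trans x≤y) (sorted⇒head≤ s)

sorted-tail : ∀ {x xs} → Sorted (x ∷ xs) → Sorted xs
sorted-tail [-] = []
sorted-tail (_ ∷ s) = s

sum-map-↭ : ∀ (f : ℕ → ℕ) {X Y} → X ↭ Y → sum (map f X) ≡ sum (map f Y)
sum-map-↭ f p = sum-↭ (↭.map⁺ f p)

indicator≤ : ℕ → ℕ → ℕ
indicator≤ k x with k ≤? x
... | yes _ = 1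
... | no _ = 0

indicator≤-yes : ∀ {k x} → k ≤ x → indicator≤ k x ≡ 1
indicator≤-yes {k} {x} k≤x with k ≤? x
... | yes _ = refl
... | no k≰x = ⊥-elim (k≰x k≤x)

indicator≤-no : ∀ {k x} → x < k → indicator≤ k x ≡ 0
indicator≤-no {k} {x} x<k with k ≤? x
... | yes k≤x = ⊥-elim (<⇒≱ x<k k≤x)
... | no _ = refl

indicator≤-≤1 : ∀ k x → indicator≤ k x ≤ 1
indicator≤-≤1 k x with k ≤? x
... | yes _ = ≤-refl
... | no _ = z≤n

indicator≤-monoʳ : ∀ k {x y} → x ≤ y → indicator≤ k x ≤ indicator≤ k y
indicator≤-monoʳ k {x} {y} x≤y with k ≤? x | k ≤? y
... | yes _ | yes _ = ≤-refl
... | yes k≤x | no k≰y = ⊥-elim (k≰y (≤-trans k≤x x≤y))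
... | no _ | _ = z≤n

indicator≤-monoˡ : ∀ {k l} x → k ≤ l → indicator≤ l x ≤ indicator≤ k x
indicator≤-monoˡ {k} {l} x k≤l with k ≤? x | l ≤? x
... | yes _ | yes _ = ≤-refl
... | no k≰x | yes l≤x = ⊥-elim (k≰x (≤-trans k≤l l≤x))
... | _ | no _ = z≤n

count≥ : ℕ → List ℕ → ℕ
count≥ k X = sum (map (indicator≤ k) X)

count≥-≤-length : ∀ k X → count≥ k X ≤ length X
count≥-≤-length k [] = z≤n
count≥-≤-length k (x ∷ X) = +-mono-≤ (indicator≤-≤1 k x) (count≥-≤-length k X)

count≥-all : ∀ {k X} → All (k ≤_) X → count≥ k X ≡ length X
count≥-all [] = refl
count≥-all (k≤x ∷ ps) = cong₂ _+_ (indicator≤-yes k≤x) (count≥-all ps)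

count≥-antitone : ∀ {k l} X → k ≤ l → count≥ l X ≤ count≥ k X
count≥-antitone [] k≤l = z≤n
count≥-antitone (x ∷ X) k≤l = +-mono-≤ (indicator≤-monoˡ x k≤l) (count≥-antitone X k≤l)

count≥-below-head : ∀ {k x} X → x < k → count≥ k (x ∷ X) ≡ count≥ k X
count≥-below-head {k} X x<k = cong (_+ count≥ k X) (indicator≤-no x<k)

count≥-sorted-tail : ∀ {k x X} → Sorted (x ∷ X) → k ≤ x → count≥ k X ≡ length X
count≥-sorted-tail s k≤x = count≥-all (All.map (≤-trans k≤x) (sorted⇒head≤ s))

count≥-↭ : ∀ k {X Y} → X ↭ Y → count≥ k X ≡ count≥ k Y
count≥-↭ k = sum-map-↭ (indicator≤ k)

addAtℕ : ℕ → ℕ → List ℕ → List ℕ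
addAtℕ i c [] = []
addAtℕ zero c (y ∷ ys) = y + c ∷ ys
addAtℕ (suc i) c (y ∷ ys) = y ∷ addAtℕ i c ys

length-addAtℕ : ∀ a c X → length (addAtℕ a c X) ≡ length X
length-addAtℕ a c [] = refl
length-addAtℕ zero c (x ∷ X) = refl
length-addAtℕ (suc a) c (x ∷ X) = cong suc (length-addAtℕ a c X)

sum-addAtℕ : ∀ a c X → a < length X → sum (addAtℕ a c X) ≡ sum X + c
sum-addAtℕ zero c (x ∷ X) _ = xy∙z≈xz∙y x c (sum X)
sum-addAtℕ (suc a) c (x ∷ X) (s≤s a<) = trans (cong (x +_) (sum-addAtℕ a c X a<)) (sym (+-assoc x (sum X) c))

All-addAtℕ : ∀ {P : ℕ → Set} a c {X} → (∀ {x} → P x → P (x + c)) → All P X → All P (addAtℕ a c X)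
All-addAtℕ a c f [] = []
All-addAtℕ zero c f (px ∷ ps) = f px ∷ ps
All-addAtℕ (suc a) c f (px ∷ ps) = px ∷ All-addAtℕ a c f ps

count≥-addAtℕ-≥ : ∀ k a c X → count≥ k X ≤ count≥ k (addAtℕ a c X)
count≥-addAtℕ-≥ k a c [] = z≤n
count≥-addAtℕ-≥ k zero c (x ∷ X) = +-monoˡ-≤ (count≥ k X) (indicator≤-monoʳ k (m≤m+n x c))
count≥-addAtℕ-≥ k (suc a) c (x ∷ X) = +-monoʳ-≤ (indicator≤ k x) (count≥-addAtℕ-≥ k a c X)

count≥-addAtℕ-≤ : ∀ k a c X → count≥ k (addAtℕ a c X) ≤ suc (count≥ k X)
count≥-addAtℕ-≤ k a c [] = z≤n
count≥-addAtℕ-≤ k zero c (x ∷ X) = +-monoˡ-≤ (count≥ k X) (≤-trans (indicator≤-≤1 k (x + c)) (s≤s z≤n))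
count≥-addAtℕ-≤ k (suc a) c (x ∷ X) =
  subst (indicator≤ k x + count≥ k (addAtℕ a c X) ≤_) (+-suc (indicator≤ k x) (count≥ k X))
        (+-monoʳ-≤ (indicator≤ k x) (count≥-addAtℕ-≤ k a c X))

count≥-addAtℕ-above : ∀ k a c X → Sorted X → a < length X → length X ≤ a + count≥ k X →
                      count≥ k (addAtℕ a c X) ≡ count≥ k X
count≥-addAtℕ-above k zero c (x ∷ X) s _ le with k ≤? x
... | yes k≤x = cong (_+ count≥ k X) (indicator≤-yes (≤-trans k≤x (m≤m+n x c)))
... | no _ = ⊥-elim (<⇒≱ (s≤s (count≥-≤-length k X)) le)
count≥-addAtℕ-above k (suc a) c (x ∷ X) s (s≤s a<) le with k ≤? x
... | yes k≤x = cong suc (count≥-addAtℕ-above k a c X (sorted-tail s) a<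
                  (subst (_≤ a + count≥ k X) (count≥-sorted-tail s k≤x) (m≤n+m _ a)))
... | no _ = count≥-addAtℕ-above k a c X (sorted-tail s) a< (s≤s⁻¹ le)

progression : ℕ → ℕ → ℕ → List ℕ
progression b d zero = []
progression b d (suc c) = b ∷ progression (b + d) d c

length-progression : ∀ b d c → length (progression b d c) ≡ c
length-progression b d zero = refl
length-progression b d (suc c) = cong suc (length-progression (b + d) d c)

progression-≥ : ∀ b d c → All (b ≤_) (progression b d c)
progression-≥ b d zero = []
progression-≥ b d (suc c) = ≤-refl ∷ All.map (≤-trans (m≤m+n b d)) (progression-≥ (b + d) d c)

progression-≤ : ∀ b d c → All (_≤ b + c * d) (progression b d c)
progression-≤ b d zero = []
progression-≤ b d (suc c) = m≤m+n b (suc c * d) ∷ subst (λ t → All (_≤ t) (progression (b + d) d c))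
                                                          (+-assoc b d (c * d)) (progression-≤ (b + d) d c)

progression-sorted : ∀ b d c → Sorted (progression b d c)
progression-sorted b d zero = []
progression-sorted b d (suc zero) = [-]
progression-sorted b d (suc (suc c)) = m≤m+n b d ∷ progression-sorted (b + d) d (suc c)

progression-∷ʳ : ∀ b d c → progression b d (suc c) ≡ progression b d c ∷ʳ (b + c * d)
progression-∷ʳ b d zero = cong [_] (sym (+-identityʳ b))
progression-∷ʳ b d (suc c) =
  cong (b ∷_) (trans (progression-∷ʳ (b + d) d c) (cong (progression (b + d) d c ∷ʳ_) (+-assoc b d (c * d))))

map-progression : ∀ s b d c → map (_+ s) (progression b d c) ≡ progression (b + s) d c
map-progression s b d zero = refl
map-progression s b d (suc c) =
  cong (b + s ∷_) (trans (map-progression s (b + d) d c) (cong (λ t → progression t d c) (xy∙z≈xz∙y b d s)))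

count≥-progression : ∀ {k b d c} → k ≤ b → count≥ k (progression b d c) ≡ c
count≥-progression {k} {b} {d} {c} k≤b =
  trans (count≥-all (All.map (≤-trans k≤b) (progression-≥ b d c))) (length-progression b d c)

count≥-progression-≥ : ∀ k b d c s → k ≤ b + s * d → c ∸ s ≤ count≥ k (progression b d c)
count≥-progression-≥ k b d zero s _ = ≤-reflexive (0∸n≡0 s)
count≥-progression-≥ k b d (suc c) zero k≤b+0 =
  ≤-reflexive (sym (count≥-progression (subst (k ≤_) (+-identityʳ b) k≤b+0)))
count≥-progression-≥ k b d (suc c) (suc s) k≤ =
  ≤-trans (count≥-progression-≥ k (b + d) d c s (subst (k ≤_) (sym (+-assoc b d (s * d))) k≤))
          (m≤n+m _ (indicator≤ k b))

-- The hypothesis b + s d < k + d (rather than b + (s − 1) d < k) avoids truncated subtraction at s = 0.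
count≥-progression-≤ : ∀ k b d c s → b + s * d < k + d → count≥ k (progression b d c) ≤ c ∸ s
count≥-progression-≤ k b d zero s _ = z≤n
count≥-progression-≤ k b d (suc c) zero _ =
  subst (count≥ k (progression b d (suc c)) ≤_) (length-progression b d (suc c))
        (count≥-≤-length k (progression b d (suc c)))
count≥-progression-≤ k b d (suc c) (suc s) lt = begin
  count≥ k (b ∷ P)  ≡⟨ count≥-below-head P b<k ⟩
  count≥ k P        ≤⟨ count≥-progression-≤ k (b + d) d c s (subst (_< k + d) (sym (+-assoc b d (s * d))) lt) ⟩
  c ∸ s             ∎
  where
  open ≤-Reasoning
  P : List ℕ
  P = progression (b + d) d c
  b<k : b < k
  b<k = +-cancelʳ-< d b k (≤-<-trans (+-monoʳ-≤ b (m≤m+n d (s * d))) lt)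

progression-mono : ∀ {b b' d d'} c → b ≤ b' → d ≤ d' → Pointwise _≤_ (progression b d c) (progression b' d' c)
progression-mono zero b≤b' d≤d' = []
progression-mono (suc c) b≤b' d≤d' = b≤b' ∷ progression-mono c (+-mono-≤ b≤b' d≤d') d≤d'

count< : ℕ → List ℕ → ℕ
count< i w = sum (map (λ a → indicator≤ (suc a) i) w)

count<-↭ : ∀ i {v w} → v ↭ w → count< i v ≡ count< i w
count<-↭ i = sum-map-↭ (λ a → indicator≤ (suc a) i)

count<-all-≥ : ∀ {i w} → All (i ≤_) w → count< i w ≡ 0
count<-all-≥ [] = refl
count<-all-≥ (i≤a ∷ ps) = cong₂ _+_ (indicator≤-no (s≤s i≤a)) (count<-all-≥ ps)

replicate-0-≤ : ∀ w → Pointwise _≤_ (replicate (length w) 0) w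
replicate-0-≤ [] = []
replicate-0-≤ (a ∷ w) = z≤n ∷ replicate-0-≤ w

sum-map-≡0 : ∀ (f : ℕ → ℕ) X → sum (map f X) ≡ 0 → All (λ x → f x ≡ 0) X
sum-map-≡0 f [] _ = []
sum-map-≡0 f (x ∷ X) eq = m+n≡0⇒m≡0 (f x) eq ∷ sum-map-≡0 f X (m+n≡0⇒n≡0 (f x) eq)

sum-≥ : ∀ {L} X → All (L ≤_) X → length X * L ≤ sum X
sum-≥ [] [] = z≤n
sum-≥ (x ∷ X) (L≤x ∷ L≤X) = +-mono-≤ L≤x (sum-≥ X L≤X)

sum-≤ : ∀ {M} X → All (_≤ M) X → sum X ≤ length X * M
sum-≤ [] [] = z≤n
sum-≤ (x ∷ X) (x≤M ∷ X≤M) = +-mono-≤ x≤M (sum-≤ X X≤M)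

sum-≤-entry+ : ∀ {M} X → All (_≤ M) X → All (λ z → sum X + M ≤ z + length X * M) X
sum-≤-entry+ [] [] = []
sum-≤-entry+ {M} (x ∷ X) (x≤M ∷ X≤M) = head ∷ All.map (λ {z} → others z) (sum-≤-entry+ X X≤M)
  where
  head : x + sum X + M ≤ x + (M + length X * M)
  head = begin
    x + sum X + M           ≡⟨ +-assoc x (sum X) M ⟩
    x + (sum X + M)         ≡⟨ cong (x +_) (+-comm (sum X) M) ⟩
    x + (M + sum X)         ≤⟨ +-monoʳ-≤ x (+-monoʳ-≤ M (sum-≤ X X≤M)) ⟩
    x + (M + length X * M)  ∎
    where open ≤-Reasoning
  others : ∀ z → sum X + M ≤ z + length X * M → x + sum X + M ≤ z + (M + length X * M)
  others z le = begin
    x + sum X + M            ≡⟨ +-assoc x (sum X) M ⟩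
    x + (sum X + M)          ≤⟨ +-mono-≤ x≤M le ⟩
    M + (z + length X * M)   ≡⟨ x∙yz≈y∙xz M z _ ⟩
    z + (M + length X * M)   ∎
    where open ≤-Reasoning

sum-map-∸ : ∀ {s} X → All (s ≤_) X → sum (map (_∸ s) X) + length X * s ≡ sum X
sum-map-∸ [] [] = refl
sum-map-∸ {s} (x ∷ X) (s≤x ∷ s≤X) = begin
  (x ∸ s + sum (map (_∸ s) X)) + (s + length X * s)  ≡⟨ interchange (x ∸ s) _ s _ ⟩
  (x ∸ s + s) + (sum (map (_∸ s) X) + length X * s)  ≡⟨ cong₂ _+_ (m∸n+n≡m s≤x) (sum-map-∸ X s≤X) ⟩
  x + sum X                                          ∎
  where open ≡-Reasoning

map-+-∸ : ∀ {s} X → All (s ≤_) X → map (_+ s) (map (_∸ s) X) ≡ X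
map-+-∸ [] [] = refl
map-+-∸ (x ∷ X) (s≤x ∷ s≤X) = cong₂ _∷_ (m∸n+n≡m s≤x) (map-+-∸ X s≤X)

count≥-smaller-head : ∀ {x y X Y} → x < y → Sorted (y ∷ Y) → length X ≡ length Y →
                      count≥ y (x ∷ X) < count≥ y (y ∷ Y)
count≥-smaller-head {x} {y} {X} {Y} x<y Y↗ ∣X∣≡∣Y∣ = begin-strict
  count≥ y (x ∷ X)  ≡⟨ count≥-below-head X x<y ⟩
  count≥ y X        ≤⟨ count≥-≤-length y X ⟩
  length X          ≡⟨ ∣X∣≡∣Y∣ ⟩
  length Y          <⟨ n<1+n _ ⟩
  suc (length Y)    ≡⟨ count≥-all (≤-refl ∷ sorted⇒head≤ Y↗) ⟨
  count≥ y (y ∷ Y)  ∎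
  where open ≤-Reasoning

sorted-count≥-injective : ∀ {X Y} → Sorted X → Sorted Y → length X ≡ length Y →
                          (∀ k → count≥ k X ≡ count≥ k Y) → X ≡ Y
sorted-count≥-injective {[]} {[]} _ _ _ _ = refl
sorted-count≥-injective {x ∷ X} {y ∷ Y} X↗ Y↗ ∣X∣≡∣Y∣ same with <-cmp x y
... | tri< x<y _ _ = ⊥-elim (<-irrefl (same y) (count≥-smaller-head {X = X} x<y Y↗ (suc-injective ∣X∣≡∣Y∣)))
... | tri> _ _ y<x = ⊥-elim (<-irrefl (sym (same x)) (count≥-smaller-head {X = Y} y<x X↗ (sym (suc-injective ∣X∣≡∣Y∣))))
... | tri≈ _ refl _ = cong (x ∷_) (sorted-count≥-injective (sorted-tail X↗) (sorted-tail Y↗) (suc-injective ∣X∣≡∣Y∣)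
                                     (λ k → +-cancelˡ-≡ (indicator≤ k x) (count≥ k X) (count≥ k Y) (same k)))

monotone-bounded⇒stalls : ∀ (f : ℕ → ℕ) {b} → (∀ j → f j ≤ f (suc j)) → (∀ j → f j ≤ b) →
                          ∃[ j ] f j ≡ f (suc j)
monotone-bounded⇒stalls f {b} f↑ f≤b = search b 0 (m≤n+m b (f 0))
  where
  search : ∀ d j → b ≤ f j + d → ∃[ j ] f j ≡ f (suc j)
  search zero j b≤fj+0 = j , ≤-antisym (f↑ j) (≤-trans (f≤b (suc j)) (subst (b ≤_) (+-identityʳ (f j)) b≤fj+0))
  search (suc d) j b≤ with f j ≟ f (suc j)
  ... | yes fj≡ = j , fj≡
  ... | no fj≢ = search d (suc j) (≤-trans b≤ (subst (_≤ f (suc j) + d) (sym (+-suc (f j) d))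
                                                     (+-monoˡ-≤ d (≤∧≢⇒< (f↑ j) fj≢))))

sumBelow : ℕ → (ℕ → ℕ) → ℕ
sumBelow zero f = 0
sumBelow (suc r) f = sumBelow r f + f r

sumBelow-mono : ∀ r {f g} → (∀ k → f k ≤ g k) → sumBelow r f ≤ sumBelow r g
sumBelow-mono zero f≤g = z≤n
sumBelow-mono (suc r) f≤g = +-mono-≤ (sumBelow-mono r f≤g) (f≤g r)

sumBelow-≡⇒≡ : ∀ r {f g} → (∀ k → f k ≤ g k) → sumBelow r f ≡ sumBelow r g → ∀ k → k < r → f k ≡ g k
sumBelow-≡⇒≡ (suc r) {f} {g} f≤g eq k k<1+r
  with m≤n⇒m<n∨m≡n (sumBelow-mono r f≤g) | m≤n⇒m<n∨m≡n (s≤s⁻¹ k<1+r)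
... | inj₁ lt | _ = ⊥-elim (<-irrefl eq (+-mono-<-≤ lt (f≤g r)))
... | inj₂ eq′ | inj₁ k<r = sumBelow-≡⇒≡ r f≤g eq′ k k<r
... | inj₂ eq′ | inj₂ refl = +-cancelˡ-≡ (sumBelow r f) (f k) (g k) (trans eq (cong (_+ g k) (sym eq′)))

module IntegerModel (m' : ℕ) where

  m : ℕ
  m = suc m'

  level : ℕ → ℕ → ℕ
  level k x = (x ∸ k) / m

  level-+m-≥ : ∀ {k x} → k ≤ x → level k (x + m) ≡ suc (level k x)
  level-+m-≥ {k} {x} k≤x = begin
    (x + m ∸ k) / m            ≡⟨ cong (_/ m) (+-∸-comm m k≤x) ⟩
    (x ∸ k + m) / m            ≡⟨ m/n≡1+[m∸n]/n (m≤n+m m (x ∸ k)) ⟩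
    suc ((x ∸ k + m ∸ m) / m)  ≡⟨ cong (λ y → suc (y / m)) (m+n∸n≡m (x ∸ k) m) ⟩
    suc ((x ∸ k) / m)          ∎
    where open ≡-Reasoning

  level-+m-< : ∀ {k x} → x < k → level k (x + m) ≡ level k x
  level-+m-< {k} {x} x<k = begin
    (x + m ∸ k) / m  ≡⟨ m<n⇒m/n≡0 (m<n+o⇒m∸n<o (x + m) k (+-monoˡ-< m x<k)) ⟩
    0                ≡⟨ cong (_/ m) (m≤n⇒m∸n≡0 (<⇒≤ x<k)) ⟨
    (x ∸ k) / m      ∎
    where open ≡-Reasoning

  level-step : ∀ k x → level k x ≡ level (k + m) x + indicator≤ (k + m) x
  level-step k x with k + m ≤? x
  ... | yes k+m≤x = begin
    (x ∸ k) / m            ≡⟨ m/n≡1+[m∸n]/n (subst (_≤ x ∸ k) (m+n∸m≡n k m) (∸-monoˡ-≤ k k+m≤x)) ⟩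
    suc ((x ∸ k ∸ m) / m)  ≡⟨ cong (λ y → suc (y / m)) (∸-+-assoc x k m) ⟩
    suc ((x ∸ (k + m)) / m) ≡⟨ +-comm 1 _ ⟩
    (x ∸ (k + m)) / m + 1  ∎
    where open ≡-Reasoning
  ... | no k+m≰x = begin
    (x ∸ k) / m            ≡⟨ m<n⇒m/n≡0 (m<n+o⇒m∸n<o x k (≰⇒> k+m≰x)) ⟩
    0                      ≡⟨ cong (_/ m) (m≤n⇒m∸n≡0 (<⇒≤ (≰⇒> k+m≰x))) ⟨
    (x ∸ (k + m)) / m      ≡⟨ +-identityʳ _ ⟨
    (x ∸ (k + m)) / m + 0  ∎
    where open ≡-Reasoning

  excess : ℕ → List ℕ → ℕ
  excess k X = sum (map (level k) X)

  excess-↭ : ∀ k {X Y} → X ↭ Y → excess k X ≡ excess k Y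
  excess-↭ k = sum-map-↭ (level k)

  excess-step : ∀ k X → excess k X ≡ excess (k + m) X + count≥ (k + m) X
  excess-step k [] = refl
  excess-step k (x ∷ X) = begin
    level k x + excess k X
      ≡⟨ cong₂ _+_ (level-step k x) (excess-step k X) ⟩
    (level (k + m) x + indicator≤ (k + m) x) + (excess (k + m) X + count≥ (k + m) X)
      ≡⟨ interchange (level (k + m) x) _ _ _ ⟩
    (level (k + m) x + excess (k + m) X) + (indicator≤ (k + m) x + count≥ (k + m) X) ∎
    where open ≡-Reasoning

  excess-step-below : ∀ {k} X → m < k → excess (k ∸ m) X ≡ excess k X + count≥ k X
  excess-step-below {k} X m<k = subst (λ l → excess (k ∸ m) X ≡ excess l X + count≥ l X)
                                      (m∸n+n≡m (<⇒≤ m<k)) (excess-step (k ∸ m) X)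

  excess-map-+ : ∀ k s X → excess (k + s) (map (_+ s) X) ≡ excess k X
  excess-map-+ k s [] = refl
  excess-map-+ k s (x ∷ X) =
    cong₂ _+_ (cong (_/ m) (trans (cong₂ _∸_ (+-comm x s) (+-comm k s)) ([m+n]∸[m+o]≡n∸o s x k))) (excess-map-+ k s X)

  excess-map-∸ : ∀ k s X → excess k (map (_∸ s) X) ≡ excess (s + k) X
  excess-map-∸ k s [] = refl
  excess-map-∸ k s (x ∷ X) = cong₂ _+_ (cong (_/ m) (∸-+-assoc x s k)) (excess-map-∸ k s X)

  excess-pointwise : ∀ k {X Y} → Pointwise _≤_ X Y → excess k X ≤ excess k Y
  excess-pointwise k [] = ≤-refl
  excess-pointwise k (x≤y ∷ X≤Y) = +-mono-≤ (/-monoˡ-≤ m (∸-monoˡ-≤ k x≤y)) (excess-pointwise k X≤Y)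

  excess-≡0 : ∀ {k X} → All (_≤ k) X → excess k X ≡ 0
  excess-≡0 [] = refl
  excess-≡0 (x≤k ∷ X≤k) = cong₂ _+_ (cong (_/ m) (m≤n⇒m∸n≡0 x≤k)) (excess-≡0 X≤k)

  excess-≡0⇒< : ∀ k X → excess k X ≡ 0 → All (_< k + m) X
  excess-≡0⇒< k X eq = All.map (λ {x} → below x ∘ m/n≡0⇒m<n) (sum-map-≡0 (level k) X eq)
    where
    below : ∀ x → x ∸ k < m → x < k + m
    below x x∸k<m with x ≤? k
    ... | yes x≤k = ≤-<-trans x≤k (m<m+n k (s≤s z≤n))
    ... | no x≰k = subst (_< k + m) (m+[n∸m]≡n (<⇒≤ (≰⇒> x≰k))) (+-monoʳ-< k x∸k<m)

  excess-addAtℕ-above : ∀ k a X → Sorted X → a < length X → length X ≤ a + count≥ k X →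
                       excess k (addAtℕ a m X) ≡ suc (excess k X)
  excess-addAtℕ-above k zero (x ∷ X) s _ le with k ≤? x
  ... | yes k≤x = cong (_+ excess k X) (level-+m-≥ k≤x)
  ... | no _ = ⊥-elim (<⇒≱ (s≤s (count≥-≤-length k X)) le)
  excess-addAtℕ-above k (suc a) (x ∷ X) s (s≤s a<) le with k ≤? x
  ... | yes k≤x = trans (cong (level k x +_) (excess-addAtℕ-above k a X (sorted-tail s) a< tail-le))
                        (+-suc (level k x) (excess k X))
    where
    tail-le : length X ≤ a + count≥ k X
    tail-le = subst (_≤ a + count≥ k X) (count≥-sorted-tail s k≤x) (m≤n+m _ a)
  ... | no _ = trans (cong (level k x +_) (excess-addAtℕ-above k a X (sorted-tail s) a< (s≤s⁻¹ le)))
                     (+-suc (level k x) (excess k X))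

  excess-addAtℕ-below : ∀ k a X → Sorted X → a + count≥ k X < length X →
                       excess k (addAtℕ a m X) ≡ excess k X
  excess-addAtℕ-below k a (x ∷ X) s lt with k ≤? x
  ... | yes k≤x = ⊥-elim (m+n≮n a (suc (length X))
                    (subst (λ c → a + suc c < suc (length X)) (count≥-sorted-tail s k≤x) lt))
  excess-addAtℕ-below k zero (x ∷ X) s lt | no k≰x = cong (_+ excess k X) (level-+m-< (≰⇒> k≰x))
  excess-addAtℕ-below k (suc a) (x ∷ X) s lt | no _ =
    cong (level k x +_) (excess-addAtℕ-below k a X (sorted-tail s) (s≤s⁻¹ lt))

  -- Chips of height ≥ m make a configuration determined by its excess values (Config-≈⇒≡).
  record Config (X : List ℕ) : Set where
    field
      sorted : Sorted X
      length≡m : length X ≡ m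
      entries≥m : All (m ≤_) X
  open Config public

  count≥-≤m : ∀ k {X} → Config X → count≥ k X ≤ m
  count≥-≤m k {X} cX = subst (count≥ k X ≤_) (length≡m cX) (count≥-≤-length k X)

  count≥-≡m : ∀ {k X} → Config X → k ≤ m → count≥ k X ≡ m
  count≥-≡m cX k≤m = trans (count≥-all (All.map (≤-trans k≤m) (entries≥m cX))) (length≡m cX)

  hop : ℕ → List ℕ → List ℕ
  hop a X = sort (addAtℕ a m X)

  run : List ℕ → List ℕ → List ℕ
  run [] X = X
  run (a ∷ w) X = run w (hop a X)

  hop-↭ : ∀ a X → hop a X ↭ addAtℕ a m X
  hop-↭ a X = sort-↭ (addAtℕ a m X)

  Config-hop : ∀ a {X} → Config X → Config (hop a X)
  Config-hop a {X} cX = record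
    { sorted = sort-↗ (addAtℕ a m X)
    ; length≡m = trans (↭.↭-length (hop-↭ a X)) (trans (length-addAtℕ a m X) (length≡m cX))
    ; entries≥m = ↭.All-resp-↭ (↭-sym (hop-↭ a X))
                               (All-addAtℕ a m (λ {x} p → ≤-trans p (m≤m+n x m)) (entries≥m cX))
    }

  Config-run : ∀ w {X} → Config X → Config (run w X)
  Config-run [] cX = cX
  Config-run (a ∷ w) cX = Config-run w (Config-hop a cX)

  Config-progression : ∀ {b} d → m ≤ b → Config (progression b d m)
  Config-progression {b} d m≤b = record
    { sorted = progression-sorted b d m
    ; length≡m = length-progression b d m
    ; entries≥m = All.map (≤-trans m≤b) (progression-≥ b d m)
    }

  sum-run : ∀ v {X} → All (_< m) v → Config X → sum (run v X) ≡ sum X + length v * m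
  sum-run [] {X} [] cX = sym (+-identityʳ (sum X))
  sum-run (a ∷ v) {X} (a<m ∷ v<m) cX = begin
    sum (run v (hop a X))               ≡⟨ sum-run v v<m (Config-hop a cX) ⟩
    sum (hop a X) + length v * m        ≡⟨ cong (_+ length v * m) (sum-↭ (hop-↭ a X)) ⟩
    sum (addAtℕ a m X) + length v * m   ≡⟨ cong (_+ length v * m) (sum-addAtℕ a m X a<∣X∣) ⟩
    sum X + m + length v * m            ≡⟨ +-assoc (sum X) m _ ⟩
    sum X + length (a ∷ v) * m          ∎
    where
    open ≡-Reasoning
    a<∣X∣ : a < length X
    a<∣X∣ = subst (a <_) (sym (length≡m cX)) a<m

  hop-excess-above : ∀ k a {X} → Config X → a < m → m ≤ a + count≥ k X → excess k (hop a X) ≡ suc (excess k X)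
  hop-excess-above k a {X} cX a<m le = trans (excess-↭ k (hop-↭ a X))
    (excess-addAtℕ-above k a X (sorted cX) (subst (a <_) (sym (length≡m cX)) a<m)
                                           (subst (_≤ a + count≥ k X) (sym (length≡m cX)) le))

  hop-excess-below : ∀ k a {X} → Config X → a + count≥ k X < m → excess k (hop a X) ≡ excess k X
  hop-excess-below k a {X} cX lt = trans (excess-↭ k (hop-↭ a X))
    (excess-addAtℕ-below k a X (sorted cX) (subst (a + count≥ k X <_) (sym (length≡m cX)) lt))

  hop-excess-≥ : ∀ k a {X} → Config X → a < m → excess k X ≤ excess k (hop a X)
  hop-excess-≥ k a {X} cX a<m with m ≤? a + count≥ k X
  ... | yes p = ≤-trans (n≤1+n _) (≤-reflexive (sym (hop-excess-above k a cX a<m p)))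
  ... | no p = ≤-reflexive (sym (hop-excess-below k a cX (≰⇒> p)))

  hop-excess-≤ : ∀ k a {X} → Config X → a < m → excess k (hop a X) ≤ suc (excess k X)
  hop-excess-≤ k a {X} cX a<m with m ≤? a + count≥ k X
  ... | yes p = ≤-reflexive (hop-excess-above k a cX a<m p)
  ... | no p = ≤-trans (≤-reflexive (hop-excess-below k a cX (≰⇒> p))) (n≤1+n _)

  count≥-hop-≥ : ∀ k a X → count≥ k X ≤ count≥ k (hop a X)
  count≥-hop-≥ k a X = subst (count≥ k X ≤_) (sym (count≥-↭ k (hop-↭ a X))) (count≥-addAtℕ-≥ k a m X)

  count≥-hop-≤ : ∀ k a X → count≥ k (hop a X) ≤ suc (count≥ k X)
  count≥-hop-≤ k a X = subst (_≤ suc (count≥ k X)) (sym (count≥-↭ k (hop-↭ a X))) (count≥-addAtℕ-≤ k a m X)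

  count≥-hop-above : ∀ k a {X} → Config X → a < m → m ≤ a + count≥ k X → count≥ k (hop a X) ≡ count≥ k X
  count≥-hop-above k a {X} cX a<m le = trans (count≥-↭ k (hop-↭ a X))
    (count≥-addAtℕ-above k a m X (sorted cX) (subst (a <_) (sym (length≡m cX)) a<m)
                                             (subst (_≤ a + count≥ k X) (sym (length≡m cX)) le))

  -- The componentwise order would not do: raising a letter does not preserve it (hop-raise).
  record _⊑_ (X Y : List ℕ) : Set where
    constructor excess-≤⇒⊑
    field excess-≤ : ∀ k → excess k X ≤ excess k Y
  open _⊑_

  ⊑-refl : ∀ {X} → X ⊑ X
  ⊑-refl = excess-≤⇒⊑ λ k → ≤-refl

  ⊑-trans : ∀ {X Y Z} → X ⊑ Y → Y ⊑ Z → X ⊑ Z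
  ⊑-trans X⊑Y Y⊑Z = excess-≤⇒⊑ λ k → ≤-trans (excess-≤ X⊑Y k) (excess-≤ Y⊑Z k)

  excess-strict : ∀ k {X Y} → Config X → Config Y → X ⊑ Y → count≥ k Y < count≥ k X → excess k X < excess k Y
  excess-strict k {X} {Y} cX cY X⊑Y lt with k ≤? m
  ... | yes k≤m = ⊥-elim (<⇒≱ lt (subst (count≥ k X ≤_) (sym (count≥-≡m cY k≤m)) (count≥-≤m k cX)))
  ... | no k≰m = +-cancelʳ-< (count≥ k X) (excess k X) (excess k Y) (begin-strict
    excess k X + count≥ k X  ≡⟨ excess-step-below X (≰⇒> k≰m) ⟨
    excess (k ∸ m) X         ≤⟨ excess-≤ X⊑Y (k ∸ m) ⟩
    excess (k ∸ m) Y         ≡⟨ excess-step-below Y (≰⇒> k≰m) ⟩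
    excess k Y + count≥ k Y  <⟨ +-monoʳ-< (excess k Y) lt ⟩
    excess k Y + count≥ k X  ∎)
    where open ≤-Reasoning

  hop-mono : ∀ a {X Y} → Config X → Config Y → a < m → X ⊑ Y → hop a X ⊑ hop a Y
  hop-mono a {X} {Y} cX cY a<m X⊑Y = excess-≤⇒⊑ go
    where
    go : ∀ k → excess k (hop a X) ≤ excess k (hop a Y)
    go k with m ≤? a + count≥ k X | m ≤? a + count≥ k Y
    ... | yes p | yes q = subst₂ _≤_ (sym (hop-excess-above k a cX a<m p)) (sym (hop-excess-above k a cY a<m q))
                                 (s≤s (excess-≤ X⊑Y k))
    ... | no p | no q = subst₂ _≤_ (sym (hop-excess-below k a cX (≰⇒> p))) (sym (hop-excess-below k a cY (≰⇒> q)))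
                               (excess-≤ X⊑Y k)
    ... | no p | yes q = subst₂ _≤_ (sym (hop-excess-below k a cX (≰⇒> p))) (sym (hop-excess-above k a cY a<m q))
                                (m≤n⇒m≤1+n (excess-≤ X⊑Y k))
    ... | yes p | no q = subst₂ _≤_ (sym (hop-excess-above k a cX a<m p)) (sym (hop-excess-below k a cY (≰⇒> q)))
                                (excess-strict k cX cY X⊑Y (+-cancelˡ-< a _ _ (<-≤-trans (≰⇒> q) p)))

  hop-raise : ∀ {a b X} → Config X → a ≤ b → b < m → hop a X ⊑ hop b X
  hop-raise {a} {b} {X} cX a≤b b<m = excess-≤⇒⊑ go
    where
    go : ∀ k → excess k (hop a X) ≤ excess k (hop b X)
    go k with m ≤? a + count≥ k X
    ... | yes p = ≤-reflexive (trans (hop-excess-above k a cX (≤-<-trans a≤b b<m) p)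
                                     (sym (hop-excess-above k b cX b<m (≤-trans p (+-monoˡ-≤ (count≥ k X) a≤b)))))
    ... | no p = ≤-trans (≤-reflexive (hop-excess-below k a cX (≰⇒> p))) (hop-excess-≥ k b cX b<m)

  hop-swap : ∀ {a b X} → Config X → a < b → b < m → hop a (hop b X) ⊑ hop b (hop a X)
  hop-swap {a} {b} {X} cX a<b b<m = excess-≤⇒⊑ go
    where
    go : ∀ k → excess k (hop a (hop b X)) ≤ excess k (hop b (hop a X))
    go k with m ≤? a + count≥ k X | m ≤? b + count≥ k X
    ... | yes p | _ = begin
      excess k (hop a (hop b X))  ≤⟨ hop-excess-≤ k a (Config-hop b cX) a<m ⟩
      suc (excess k (hop b X))    ≤⟨ s≤s (hop-excess-≤ k b cX b<m) ⟩
      suc (suc (excess k X))      ≡⟨ cong suc (hop-excess-above k a cX a<m p) ⟨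
      suc (excess k (hop a X))    ≡⟨ hop-excess-above k b (Config-hop a cX) b<m
                                       (≤-trans p (+-mono-≤ (<⇒≤ a<b) (count≥-hop-≥ k a X))) ⟨
      excess k (hop b (hop a X))  ∎
      where
      open ≤-Reasoning
      a<m : a < m
      a<m = <-trans a<b b<m
    ... | no p | yes q = ≤-reflexive (begin
      excess k (hop a (hop b X))  ≡⟨ hop-excess-below k a (Config-hop b cX)
                                       (subst (λ c → a + c < m) (sym (count≥-hop-above k b cX b<m q)) (≰⇒> p)) ⟩
      excess k (hop b X)          ≡⟨ hop-excess-above k b cX b<m q ⟩
      suc (excess k X)            ≡⟨ cong suc (hop-excess-below k a cX (≰⇒> p)) ⟨
      suc (excess k (hop a X))    ≡⟨ hop-excess-above k b (Config-hop a cX) b<m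
                                       (≤-trans q (+-monoʳ-≤ b (count≥-hop-≥ k a X))) ⟨
      excess k (hop b (hop a X))  ∎)
      where open ≡-Reasoning
    ... | _ | no q = begin
      excess k (hop a (hop b X))  ≡⟨ hop-excess-below k a (Config-hop b cX) (begin-strict
                                       a + count≥ k (hop b X)  ≤⟨ +-monoʳ-≤ a (count≥-hop-≤ k b X) ⟩
                                       a + suc (count≥ k X)    ≡⟨ +-suc a (count≥ k X) ⟩
                                       suc a + count≥ k X      ≤⟨ +-monoˡ-≤ (count≥ k X) a<b ⟩
                                       b + count≥ k X          <⟨ ≰⇒> q ⟩
                                       m                       ∎) ⟩
      excess k (hop b X)          ≡⟨ hop-excess-below k b cX (≰⇒> q) ⟩
      excess k X                  ≤⟨ hop-excess-≥ k a cX (<-trans a<b b<m) ⟩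
      excess k (hop a X)          ≤⟨ hop-excess-≥ k b (Config-hop a cX) b<m ⟩
      excess k (hop b (hop a X))  ∎
      where open ≤-Reasoning

  run-mono : ∀ w {X Y} → All (_< m) w → Config X → Config Y → X ⊑ Y → run w X ⊑ run w Y
  run-mono [] _ _ _ X⊑Y = X⊑Y
  run-mono (a ∷ w) (a<m ∷ w<m) cX cY X⊑Y =
    run-mono w w<m (Config-hop a cX) (Config-hop a cY) (hop-mono a cX cY a<m X⊑Y)

  run-insert : ∀ a w {X} → a < m → All (_< m) w → Config X → run w (hop a X) ⊑ run (insert a w) X
  run-insert a [] a<m [] cX = ⊑-refl
  run-insert a (b ∷ w) a<m (b<m ∷ w<m) cX with a ≤ᵇ b | ≤ᵇ-reflects-≤ a b
  ... | true | _ = ⊑-refl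
  ... | false | ofⁿ a≰b = ⊑-trans (run-mono w w<m (Config-hop b (Config-hop a cX)) (Config-hop a (Config-hop b cX))
                                   (hop-swap cX (≰⇒> a≰b) a<m))
                         (run-insert a w a<m w<m (Config-hop b cX))

  run-sort : ∀ w {X} → All (_< m) w → Config X → run w X ⊑ run (sort w) X
  run-sort [] [] cX = ⊑-refl
  run-sort (a ∷ w) (a<m ∷ w<m) cX =
    ⊑-trans (run-sort w w<m (Config-hop a cX))
            (run-insert a (sort w) a<m (↭.All-resp-↭ (↭-sym (sort-↭ w)) w<m) cX)

  run-raise : ∀ {v w X} → Pointwise _≤_ v w → All (_< m) w → Config X → run v X ⊑ run w X
  run-raise [] [] cX = ⊑-refl
  run-raise {a ∷ v} {b ∷ w} (a≤b ∷ v≤w) (b<m ∷ w<m) cX =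
    ⊑-trans (run-raise v≤w w<m (Config-hop a cX))
            (run-mono w w<m (Config-hop a cX) (Config-hop b cX) (hop-raise cX a≤b b<m))

  record _≈_ (X Y : List ℕ) : Set where
    constructor excess-≡⇒≈
    field excess-≡ : ∀ k → excess k X ≡ excess k Y
  open _≈_

  ≈⇒count≥≡ : ∀ {X Y} → Config X → length Y ≡ m → All (m ≤_) Y → X ≈ Y →
              ∀ k → count≥ k X ≡ count≥ k Y
  ≈⇒count≥≡ {X} {Y} cX ∣Y∣≡m Y≥m X≈Y k with k ≤? m
  ... | yes k≤m = trans (count≥-≡m cX k≤m) (sym (trans (count≥-all (All.map (≤-trans k≤m) Y≥m)) ∣Y∣≡m))
  ... | no k≰m = +-cancelˡ-≡ (excess k X) (count≥ k X) (count≥ k Y) (begin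
    excess k X + count≥ k X  ≡⟨ excess-step-below X (≰⇒> k≰m) ⟨
    excess (k ∸ m) X         ≡⟨ excess-≡ X≈Y (k ∸ m) ⟩
    excess (k ∸ m) Y         ≡⟨ excess-step-below Y (≰⇒> k≰m) ⟩
    excess k Y + count≥ k Y  ≡⟨ cong (_+ count≥ k Y) (excess-≡ X≈Y k) ⟨
    excess k X + count≥ k Y  ∎)
    where open ≡-Reasoning

  Config-≈⇒≡ : ∀ {X Y} → Config X → Config Y → X ≈ Y → X ≡ Y
  Config-≈⇒≡ cX cY X≈Y = sorted-count≥-injective (sorted cX) (sorted cY) (trans (length≡m cX) (sym (length≡m cY)))
                                                 (≈⇒count≥≡ cX (length≡m cY) (entries≥m cY) X≈Y)

  ≈-↭ : ∀ {X Y Z} → X ≈ Y → Y ↭ Z → X ≈ Z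
  ≈-↭ X≈Y Y↭Z = excess-≡⇒≈ λ k → trans (excess-≡ X≈Y k) (excess-↭ k Y↭Z)

  -- The last two hypotheses say that position a of the sorted configuration holds the chip v.
  hop-moves : ∀ {a v R X} → Config X → length R ≡ m' → All (m ≤_) (v ∷ R) → X ≈ (v ∷ R) → a < m →
              m ≤ a + count≥ v (v ∷ R) → a + count≥ (suc v) (v ∷ R) < m → hop a X ≈ (v + m ∷ R)
  hop-moves {a} {v} {R} {X} cX ∣R∣≡m' vR≥m X≈vR a<m above below = excess-≡⇒≈ go
    where
    go : ∀ k → excess k (hop a X) ≡ excess k (v + m ∷ R)
    go k with k ≤? v
    ... | yes k≤v = begin
      excess k (hop a X)            ≡⟨ hop-excess-above k a cX a<m (≤-trans above (+-monoʳ-≤ a count≥v≤)) ⟩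
      suc (excess k X)              ≡⟨ cong suc (excess-≡ X≈vR k) ⟩
      suc (level k v + excess k R)  ≡⟨ cong (_+ excess k R) (level-+m-≥ k≤v) ⟨
      excess k (v + m ∷ R)          ∎
      where
      open ≡-Reasoning
      count≥v≤ : count≥ v (v ∷ R) ≤ count≥ k X
      count≥v≤ = subst (count≥ v (v ∷ R) ≤_) (sym (≈⇒count≥≡ cX (cong suc ∣R∣≡m') vR≥m X≈vR k))
                       (count≥-antitone (v ∷ R) k≤v)
    ... | no k≰v = begin
      excess k (hop a X)     ≡⟨ hop-excess-below k a cX (≤-<-trans (+-monoʳ-≤ a count≥k≤) below) ⟩
      excess k X             ≡⟨ excess-≡ X≈vR k ⟩
      level k v + excess k R ≡⟨ cong (_+ excess k R) (level-+m-< (≰⇒> k≰v)) ⟨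
      excess k (v + m ∷ R)   ∎
      where
      open ≡-Reasoning
      count≥k≤ : count≥ k X ≤ count≥ (suc v) (v ∷ R)
      count≥k≤ = subst (_≤ count≥ (suc v) (v ∷ R)) (sym (≈⇒count≥≡ cX (cong suc ∣R∣≡m') vR≥m X≈vR k))
                       (count≥-antitone (v ∷ R) (≰⇒> k≰v))

  hop-0-progression : ∀ {v X} → Config X → m ≤ v → X ≈ progression v 1 m → hop 0 X ≈ progression (v + 1) 1 m
  hop-0-progression {v} {X} cX m≤v X≈P =
    ≈-↭ (hop-moves cX (length-progression (v + 1) 1 m') (All.map (≤-trans m≤v) (progression-≥ v 1 m)) X≈P (s≤s z≤n)
           (≤-reflexive (sym (count≥-progression ≤-refl)))
           (s≤s (begin
              count≥ (suc v) (v ∷ R)  ≡⟨ count≥-below-head R ≤-refl ⟩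
              count≥ (suc v) R        ≤⟨ count≥-≤-length (suc v) R ⟩
              length R                ≡⟨ length-progression (v + 1) 1 m' ⟩
              m'                      ∎)))
        (↭-trans (↭.∷↭∷ʳ (v + m) R)
                 (↭-reflexive (trans (cong (R ∷ʳ_) (last v m')) (sym (progression-∷ʳ (v + 1) 1 m')))))
    where
    open ≤-Reasoning
    R : List ℕ
    R = progression (v + 1) 1 m'
    last : ∀ v m' → v + suc m' ≡ v + 1 + m' * 1
    last = solve-∀

  run-zeros-progression : ∀ c {v X} → Config X → m ≤ v → X ≈ progression v 1 m →
                          run (replicate c 0) X ≈ progression (v + c) 1 m
  run-zeros-progression zero {v} {X} cX _ X≈P = subst (λ u → X ≈ progression u 1 m) (sym (+-identityʳ v)) X≈P
  run-zeros-progression (suc c) {v} {X} cX m≤v X≈P =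
    subst (λ u → run (replicate (suc c) 0) X ≈ progression u 1 m) (+-assoc v 1 c)
          (run-zeros-progression c (Config-hop 0 cX) (≤-trans m≤v (m≤m+n v 1)) (hop-0-progression cX m≤v X≈P))

  subsolution : ∀ {B w} → m ≤ B → All (_< m) w → progression B 1 m ⊑ map (_∸ length w) (run w (progression B 1 m))
  subsolution {B} {w} m≤B w<m = excess-≤⇒⊑ λ k → begin
    excess k E                                ≡⟨ excess-map-+ k c E ⟨
    excess (k + c) (map (_+ c) E)             ≡⟨ cong (excess (k + c)) (map-progression c B 1 m) ⟩
    excess (k + c) (progression (B + c) 1 m)  ≡⟨ excess-≡ (run-zeros-progression c cE m≤B E≈E) (k + c) ⟨
    excess (k + c) (run (replicate c 0) E)    ≤⟨ excess-≤ (run-raise (replicate-0-≤ w) w<m cE) (k + c) ⟩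
    excess (k + c) (run w E)                  ≡⟨ cong (λ l → excess l (run w E)) (+-comm k c) ⟩
    excess (c + k) (run w E)                  ≡⟨ excess-map-∸ k c (run w E) ⟨
    excess k (map (_∸ c) (run w E))           ∎
    where
    open ≤-Reasoning
    E : List ℕ
    E = progression B 1 m
    c : ℕ
    c = length w
    cE : Config E
    cE = Config-progression 1 m≤B
    E≈E : E ≈ E
    E≈E = excess-≡⇒≈ λ _ → refl

  module Staircase (n' : ℕ) where

    n : ℕ
    n = suc n'

    stair : ℕ → ℕ
    stair t = (t * m) / n

    staircase : ℕ → ℕ → List ℕ
    staircase t zero = []
    staircase t (suc c) = stair t ∷ staircase (suc t) c

    stair-floor : ∀ t → t * m < suc (stair t) * n
    stair-floor t = begin-strict
      t * m                       ≡⟨ m≡m%n+[m/n]*n (t * m) n ⟩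
      (t * m) % n + stair t * n   <⟨ +-monoˡ-< (stair t * n) (m%n<n (t * m) n) ⟩
      n + stair t * n             ∎
      where open ≤-Reasoning

    stair-< : ∀ {t} → t < n → stair t < m
    stair-< {t} t<n = m<n*o⇒m/o<n (subst (t * m <_) (*-comm n m) (*-monoˡ-< m t<n))

    staircase-< : ∀ t c → t + c ≤ n → All (_< m) (staircase t c)
    staircase-< t zero _ = []
    staircase-< t (suc c) t+c<n =
      stair-< (≤-trans (s≤s (m≤m+n t c)) t+1+c≤n) ∷ staircase-< (suc t) c t+1+c≤n
      where
      t+1+c≤n : suc t + c ≤ n
      t+1+c≤n = subst (_≤ n) (+-suc t c) t+c<n

    Parking : List ℕ → Set
    Parking w = ∀ i → i ≤ m → i * n ≤ m * count< i w

    -- s is a sorted suffix of a parking word, following t letters already matched with the staircase.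
    sorted-parking-≤-staircase : ∀ t s → Sorted s → All (_< m) s → (∀ i → i ≤ m → i * n ≤ m * (t + count< i s)) →
                                 Pointwise _≤_ s (staircase t (length s))
    sorted-parking-≤-staircase t [] _ _ _ = []
    sorted-parking-≤-staircase t (a ∷ s) s↗ (a<m ∷ s<m) parking =
      a≤stair ∷ sorted-parking-≤-staircase (suc t) s (sorted-tail s↗) s<m parking′
      where
      a≤stair : a ≤ stair t
      a≤stair = ≮⇒≥ λ stair<a → <⇒≱ (stair-floor t) (subst (suc (stair t) * n ≤_) (*-comm m t) (blocked stair<a))
        where
        blocked : stair t < a → suc (stair t) * n ≤ m * t
        blocked i≤a = subst (λ c → suc (stair t) * n ≤ m * c)
                            (trans (cong (t +_) (count<-all-≥ (i≤a ∷ All.map (≤-trans i≤a) (sorted⇒head≤ s↗))))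
                                   (+-identityʳ t))
                            (parking (suc (stair t)) (<⇒≤ (≤-<-trans i≤a a<m)))
      parking′ : ∀ i → i ≤ m → i * n ≤ m * (suc t + count< i s)
      parking′ i i≤m = ≤-trans (parking i i≤m) (*-monoʳ-≤ m (begin
        t + (indicator≤ (suc a) i + count< i s)  ≤⟨ +-monoʳ-≤ t (+-monoˡ-≤ (count< i s) (indicator≤-≤1 (suc a) i)) ⟩
        t + suc (count< i s)                     ≡⟨ +-suc t (count< i s) ⟩
        suc t + count< i s                       ∎))
        where open ≤-Reasoning

    module _ {B : ℕ} (m≤B : m ≤ B) where

      rest : List ℕ
      rest = progression (B + n) n m'

      -- The staircase letter at time t is a rank of the moving chip B + t m among B + n, B + 2n, ….
      hop-stair : ∀ {t X} → Config X → t < n → X ≈ (B + t * m ∷ rest) → hop (stair t) X ≈ (B + suc t * m ∷ rest)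
      hop-stair {t} {X} cX t<n X≈ =
        ≈-↭ (hop-moves cX (length-progression (B + n) n m')
                          (v≥m ∷ All.map (≤-trans m≤B+n) (progression-≥ (B + n) n m'))
                          X≈ (stair-< t<n) above below)
            (↭-reflexive (cong (_∷ rest) (trans (+-assoc B (t * m) m) (cong (B +_) (+-comm (t * m) m)))))
        where
        v : ℕ
        v = B + t * m
        v≥m : m ≤ v
        v≥m = ≤-trans m≤B (m≤m+n B (t * m))
        m≤B+n : m ≤ B + n
        m≤B+n = ≤-trans m≤B (m≤m+n B n)
        stair≤m' : stair t ≤ m'
        stair≤m' = s≤s⁻¹ (stair-< t<n)
        above : m ≤ stair t + count≥ v (v ∷ rest)
        above = begin
          m                               ≡⟨ cong suc (m+[n∸m]≡n stair≤m') ⟨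
          suc (stair t + (m' ∸ stair t))  ≡⟨ +-suc (stair t) _ ⟨
          stair t + suc (m' ∸ stair t)    ≤⟨ +-monoʳ-≤ (stair t) (s≤s (count≥-progression-≥ v _ n m' (stair t) v≤)) ⟩
          stair t + suc (count≥ v rest)   ≡⟨ cong (λ c → stair t + (c + count≥ v rest)) (indicator≤-yes ≤-refl) ⟨
          stair t + count≥ v (v ∷ rest)   ∎
          where
          open ≤-Reasoning
          v≤ : v ≤ B + n + stair t * n
          v≤ = begin
            B + t * m              ≤⟨ +-monoʳ-≤ B (<⇒≤ (stair-floor t)) ⟩
            B + (n + stair t * n)  ≡⟨ +-assoc B n _ ⟨
            B + n + stair t * n    ∎
        below : stair t + count≥ (suc v) (v ∷ rest) < m
        below = begin-strict
          stair t + count≥ (suc v) (v ∷ rest)  ≡⟨ cong (stair t +_) (count≥-below-head rest ≤-refl) ⟩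
          stair t + count≥ (suc v) rest        ≤⟨ +-monoʳ-≤ (stair t) (count≥-progression-≤ (suc v) _ n m' (stair t) lt) ⟩
          stair t + (m' ∸ stair t)             ≡⟨ m+[n∸m]≡n stair≤m' ⟩
          m'                                   <⟨ n<1+n m' ⟩
          m                                    ∎
          where
          open ≤-Reasoning
          lt : B + n + stair t * n < suc v + n
          lt = begin-strict
            B + n + stair t * n  ≡⟨ xy∙z≈xz∙y B n _ ⟩
            B + stair t * n + n  <⟨ +-monoˡ-< n (s≤s (+-monoʳ-≤ B (m/n*n≤m (t * m) n))) ⟩
            suc v + n            ∎

      run-staircase : ∀ c {t X} → Config X → t + c ≤ n → X ≈ (B + t * m ∷ rest) →
                      run (staircase t c) X ≈ (B + (t + c) * m ∷ rest)
      run-staircase zero {t} {X} cX _ X≈ = subst (λ u → X ≈ (B + u * m ∷ rest)) (sym (+-identityʳ t)) X≈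
      run-staircase (suc c) {t} {X} cX t+c≤n X≈ =
        subst (λ u → run (staircase t (suc c)) X ≈ (B + u * m ∷ rest)) (sym (+-suc t c))
              (run-staircase c (Config-hop (stair t) cX) t+1+c≤n (hop-stair cX (≤-trans (s≤s (m≤m+n t c)) t+1+c≤n) X≈))
        where
        t+1+c≤n : suc t + c ≤ n
        t+1+c≤n = subst (_≤ n) (+-suc t c) t+c≤n

      run-staircase-shifts : run (staircase 0 n) (progression B n m) ≈ map (_+ n) (progression B n m)
      run-staircase-shifts =
        ≈-↭ (run-staircase n (Config-progression n m≤B) ≤-refl
                           (excess-≡⇒≈ λ k → cong (λ b → excess k (b ∷ rest)) (sym (+-identityʳ B))))
            (↭-trans (↭.∷↭∷ʳ _ rest) (↭-reflexive (begin
              rest ∷ʳ (B + n * m)           ≡⟨ cong (rest ∷ʳ_) (last B n m') ⟩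
              rest ∷ʳ (B + n + m' * n)      ≡⟨ progression-∷ʳ (B + n) n m' ⟨
              progression (B + n) n m       ≡⟨ map-progression n B n m ⟨
              map (_+ n) (progression B n m) ∎)))
        where
        open ≡-Reasoning
        last : ∀ B n m' → B + n * suc m' ≡ B + n + m' * n
        last = solve-∀

      supersolution : ∀ {w} → All (_< m) w → length w ≡ n → Parking w →
                      map (_∸ n) (run w (progression B n m)) ⊑ progression B n m
      supersolution {w} w<m ∣w∣≡n parking = excess-≤⇒⊑ λ k → begin
        excess k (map (_∸ n) (run w U))       ≡⟨ excess-map-∸ k n (run w U) ⟩
        excess (n + k) (run w U)              ≤⟨ excess-≤ (run-sort w w<m cU) (n + k) ⟩
        excess (n + k) (run (sort w) U)       ≤⟨ excess-≤ (run-raise sort-w≤staircase (staircase-< 0 n ≤-refl) cU) (n + k) ⟩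
        excess (n + k) (run (staircase 0 n) U) ≡⟨ excess-≡ run-staircase-shifts (n + k) ⟩
        excess (n + k) (map (_+ n) U)         ≡⟨ cong (λ l → excess l (map (_+ n) U)) (+-comm n k) ⟩
        excess (k + n) (map (_+ n) U)         ≡⟨ excess-map-+ k n U ⟩
        excess k U                            ∎
        where
        open ≤-Reasoning
        U : List ℕ
        U = progression B n m
        cU : Config U
        cU = Config-progression n m≤B
        ∣sort-w∣≡n : length (sort w) ≡ n
        ∣sort-w∣≡n = trans (↭.↭-length (sort-↭ w)) ∣w∣≡n
        sort-w≤staircase : Pointwise _≤_ (sort w) (staircase 0 n)
        sort-w≤staircase = subst (λ c → Pointwise _≤_ (sort w) (staircase 0 c)) ∣sort-w∣≡n
          (sorted-parking-≤-staircase 0 (sort w) (sort-↗ w) (↭.All-resp-↭ (↭-sym (sort-↭ w)) w<m)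
             (λ i i≤m → subst (λ c → i * n ≤ m * c) (sym (count<-↭ i (sort-↭ w))) (parking i i≤m)))

    module Iteration {w : List ℕ} (w<m : All (_< m) w) (∣w∣≡n : length w ≡ n) (parking : Parking w) where

      -- B is large enough that, by the sum invariant, all chips of run w Y stay ≥ n + m (run-entries-≥).
      B : ℕ
      B = m + m * m' * n + m' * m'

      m≤B : m ≤ B
      m≤B = ≤-trans (m≤m+n m (m * m' * n)) (m≤m+n _ (m' * m'))

      E U : List ℕ
      E = progression B 1 m
      U = progression B n m

      cU : Config U
      cU = Config-progression n m≤B

      top : ℕ
      top = B + m * n

      excess-U-vanishes : ∀ {k} → top ≤ k → excess k U ≡ 0
      excess-U-vanishes top≤k = excess-≡0 (All.map (λ x≤top → ≤-trans x≤top top≤k) (progression-≤ B n m))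

      step : List ℕ → List ℕ
      step Y = map (_∸ n) (run w Y)

      record Good (Y : List ℕ) : Set where
        field
          config : Config Y
          ⊑U : Y ⊑ U
          sum≡ : sum Y ≡ sum E
      open Good

      run-excess-≤-U : ∀ {Y} → Good Y → ∀ k → excess (n + k) (run w Y) ≤ excess k U
      run-excess-≤-U {Y} gY k = begin
        excess (n + k) (run w Y)         ≤⟨ excess-≤ (run-mono w w<m (config gY) cU (⊑U gY)) (n + k) ⟩
        excess (n + k) (run w U)         ≡⟨ excess-map-∸ k n (run w U) ⟨
        excess k (map (_∸ n) (run w U))  ≤⟨ excess-≤ (supersolution m≤B w<m ∣w∣≡n parking) k ⟩
        excess k U                       ∎
        where open ≤-Reasoning

      sum-run-Good : ∀ {Y} → Good Y → sum (run w Y) ≡ sum E + n * m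
      sum-run-Good {Y} gY = trans (sum-run w w<m (config gY)) (cong₂ (λ s l → s + l * m) (sum≡ gY) ∣w∣≡n)

      run-entries-≥ : ∀ {Y} → Good Y → All (n + m ≤_) (run w Y)
      run-entries-≥ {Y} gY = All.map (λ {z} → bound z) (sum-≤-entry+ Z Z≤M)
        where
        Z : List ℕ
        Z = run w Y
        M : ℕ
        M = n + top + m'
        Z≤M : All (_≤ M) Z
        Z≤M = All.map (λ {z} z< → s≤s⁻¹ (subst (z <_) (+-suc (n + top) m') z<))
                      (excess-≡0⇒< (n + top) Z (n≤0⇒n≡0 (≤-trans (run-excess-≤-U gY top)
                                                                  (≤-reflexive (excess-U-vanishes ≤-refl)))))
        arithmetic : ∀ m' n' → let m = suc m'; n = suc n'; B = m + m * m' * n + m' * m'; M = n + (B + m * n) + m' in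
                     n + m + m * M ≡ m * B + n * m + M
        arithmetic = solve-∀
        bound : ∀ z → sum Z + M ≤ z + length Z * M → n + m ≤ z
        bound z le = +-cancelʳ-≤ (m * M) (n + m) z (begin
          n + m + m * M       ≡⟨ arithmetic m' n' ⟩
          m * B + n * m + M   ≤⟨ +-monoˡ-≤ M (+-monoˡ-≤ (n * m) sum-E≥) ⟩
          sum E + n * m + M   ≡⟨ cong (_+ M) (sum-run-Good gY) ⟨
          sum Z + M           ≤⟨ le ⟩
          z + length Z * M    ≡⟨ cong (λ l → z + l * M) (length≡m (Config-run w (config gY))) ⟩
          z + m * M           ∎)
          where
          open ≤-Reasoning
          sum-E≥ : m * B ≤ sum E
          sum-E≥ = subst (λ l → l * B ≤ sum E) (length-progression B 1 m) (sum-≥ E (progression-≥ B 1 m))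

      Good-step : ∀ {Y} → Good Y → Good (step Y)
      Good-step {Y} gY = record
        { config = record
          { sorted = Sorted.map⁺ ≤-totalOrder ≤-totalOrder (∸-monoˡ-≤ n) (sorted cZ)
          ; length≡m = trans (length-map (_∸ n) Z) (length≡m cZ)
          ; entries≥m = All.map⁺ (All.map (λ {z} n+m≤z → subst (_≤ z ∸ n) (m+n∸m≡n n m) (∸-monoˡ-≤ n n+m≤z))
                                          Z≥n+m)
          }
        ; ⊑U = excess-≤⇒⊑ λ k → subst (_≤ excess k U) (sym (excess-map-∸ k n Z)) (run-excess-≤-U gY k)
        ; sum≡ = +-cancelʳ-≡ (m * n) (sum (step Y)) (sum E) (begin
            sum (step Y) + m * n       ≡⟨ cong (λ l → sum (step Y) + l * n) (length≡m cZ) ⟨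
            sum (step Y) + length Z * n ≡⟨ sum-map-∸ Z (All.map (≤-trans (m≤m+n n m)) Z≥n+m) ⟩
            sum Z                      ≡⟨ sum-run-Good gY ⟩
            sum E + n * m              ≡⟨ cong (sum E +_) (*-comm n m) ⟩
            sum E + m * n              ∎)
        }
        where
        open ≡-Reasoning
        Z : List ℕ
        Z = run w Y
        cZ : Config Z
        cZ = Config-run w (config gY)
        Z≥n+m : All (n + m ≤_) Z
        Z≥n+m = run-entries-≥ gY

      step-mono : ∀ {X Y} → Good X → Good Y → X ⊑ Y → step X ⊑ step Y
      step-mono {X} {Y} gX gY X⊑Y = excess-≤⇒⊑ λ k →
        subst₂ _≤_ (sym (excess-map-∸ k n (run w X))) (sym (excess-map-∸ k n (run w Y)))
               (excess-≤ (run-mono w w<m (config gX) (config gY) X⊑Y) (n + k))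

      iterate : ℕ → List ℕ
      iterate zero = E
      iterate (suc j) = step (iterate j)

      Good-iterate : ∀ j → Good (iterate j)
      Good-iterate zero = record
        { config = Config-progression 1 m≤B
        ; ⊑U = excess-≤⇒⊑ λ k → excess-pointwise k (progression-mono m ≤-refl (s≤s z≤n))
        ; sum≡ = refl
        }
      Good-iterate (suc j) = Good-step (Good-iterate j)

      iterate-increasing : ∀ j → iterate j ⊑ iterate (suc j)
      iterate-increasing zero = subst (λ c → E ⊑ map (_∸ c) (run w E)) ∣w∣≡n (subsolution m≤B w<m)
      iterate-increasing (suc j) = step-mono (Good-iterate j) (Good-iterate (suc j)) (iterate-increasing j)

      potential : List ℕ → ℕ
      potential Y = sumBelow top (λ k → excess k Y)

      excess-Good-vanishes : ∀ {X k} → Good X → top ≤ k → excess k X ≡ 0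
      excess-Good-vanishes {X} {k} gX top≤k =
        n≤0⇒n≡0 (≤-trans (excess-≤ (⊑U gX) k) (≤-reflexive (excess-U-vanishes top≤k)))

      iterate-stalls : ∃[ j ] iterate j ≈ iterate (suc j)
      iterate-stalls = j , excess-≡⇒≈ same
        where
        stall : ∃[ j ] potential (iterate j) ≡ potential (iterate (suc j))
        stall = monotone-bounded⇒stalls (potential ∘ iterate)
                  (λ j → sumBelow-mono top (excess-≤ (iterate-increasing j)))
                  (λ j → sumBelow-mono top (excess-≤ (⊑U (Good-iterate j))))
        j : ℕ
        j = proj₁ stall
        same : ∀ k → excess k (iterate j) ≡ excess k (iterate (suc j))
        same k with k <? top
        ... | yes k<top = sumBelow-≡⇒≡ top (excess-≤ (iterate-increasing j)) (proj₂ stall) k k<top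
        ... | no k≮top = trans (excess-Good-vanishes (Good-iterate j) (≮⇒≥ k≮top))
                               (sym (excess-Good-vanishes (Good-iterate (suc j)) (≮⇒≥ k≮top)))

      fixed-point : ∃[ Y ] Config Y × run w Y ≡ map (_+ n) Y
      fixed-point = Y , config gY , (begin
        run w Y              ≡⟨ map-+-∸ (run w Y) (All.map (≤-trans (m≤m+n n m)) (run-entries-≥ gY)) ⟨
        map (_+ n) (step Y)  ≡⟨ cong (map (_+ n)) Y≡stepY ⟨
        map (_+ n) Y         ∎)
        where
        open ≡-Reasoning
        j : ℕ
        j = proj₁ iterate-stalls
        Y : List ℕ
        Y = iterate j
        gY : Good Y
        gY = Good-iterate j
        Y≡stepY : Y ≡ step Y
        Y≡stepY = Config-≈⇒≡ (config gY) (config (Good-iterate (suc j))) (proj₂ iterate-stalls)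

ι : ℕ → ℚ
ι y = ℤ.+ y ℚ./ 1

ι≡mkℚ : ∀ a → ι a ≡ mkℚ (ℤ.+ a) 0 (Coprime.sym (Coprime.1-coprimeTo a))
ι≡mkℚ a = ℚ.normalize-coprime (Coprime.sym (Coprime.1-coprimeTo a))

ι-+ : ∀ a b → ι a +ℚ ι b ≡ ι (a + b)
ι-+ a b rewrite ι≡mkℚ a | ι≡mkℚ b = cong (ℚ._/ 1) (cong₂ ℤ._+_ (ℤ.*-identityʳ (ℤ.+ a)) (ℤ.*-identityʳ (ℤ.+ b)))

ι-mono : ∀ {a b} → a ≤ b → ι a ≤ℚ ι b
ι-mono {a} {b} a≤b rewrite ι≡mkℚ a | ι≡mkℚ b =
  ℚ.*≤* (subst₂ ℤ._≤_ (sym (ℤ.*-identityʳ (ℤ.+ a))) (sym (ℤ.*-identityʳ (ℤ.+ b))) (ℤ.+≤+ a≤b))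

ι-suc-nonZero : ∀ a → ℚ.NonZero (ι (suc a))
ι-suc-nonZero a rewrite ι≡mkℚ (suc a) = _

ℚ≤-totalOrder : TotalOrder 0ℓ 0ℓ 0ℓ
ℚ≤-totalOrder = DecTotalOrder.totalOrder ℚ.≤-decTotalOrder

sort-map : ∀ (f : ℕ → ℚ) → (∀ {x y} → x ≤ y → f x ≤ℚ f y) → ∀ X → ℚSort.sort (map f X) ≡ map f (sort X)
sort-map f f-mono X = Pointwise-≡⇒≡ (Sorted.↗↭↗⇒≋ ℚ≤-totalOrder
  (ℚSort.sort-↗ (map f X))
  (Sorted.map⁺ ≤-totalOrder ℚ≤-totalOrder f-mono (sort-↗ X))
  (↭⇒↭ₛ (↭-trans (ℚSort.sort-↭ (map f X)) (↭.map⁺ f (↭-sym (sort-↭ X))))))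

addAt-map : ∀ (f : ℕ → ℚ) {c c'} → (∀ y → f (y + c) ≡ f y +ℚ c') →
            ∀ i X → addAt i c' (map f X) ≡ map f (addAtℕ i c X)
addAt-map f f-+ i [] = refl
addAt-map f f-+ zero (x ∷ X) = cong (_∷ map f X) (sym (f-+ x))
addAt-map f f-+ (suc i) (x ∷ X) = cong (f x ∷_) (addAt-map f f-+ i X)

sumℚ-map-ι : ∀ d Y → sumℚ (map (λ y → ι y -ℚ d) Y) ≡ ι (sum Y) -ℚ ι (length Y) *ℚ d
sumℚ-map-ι d [] = empty d
  where
  empty : ∀ d → 0ℚ ≡ 0ℚ -ℚ 0ℚ *ℚ d
  empty = solve 1 (λ d → con 0ℚ := con 0ℚ :- con 0ℚ :* d) refl
sumℚ-map-ι d (y ∷ Y) = begin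
  (ι y -ℚ d) +ℚ sumℚ (map (λ y → ι y -ℚ d) Y)          ≡⟨ cong ((ι y -ℚ d) +ℚ_) (sumℚ-map-ι d Y) ⟩
  (ι y -ℚ d) +ℚ (ι (sum Y) -ℚ ι (length Y) *ℚ d)       ≡⟨ regroup (ι y) (ι (sum Y)) (ι (length Y)) d ⟩
  (ι y +ℚ ι (sum Y)) -ℚ (ι 1 +ℚ ι (length Y)) *ℚ d
    ≡⟨ cong₂ (λ a l → a -ℚ l *ℚ d) (ι-+ y (sum Y)) (ι-+ 1 (length Y)) ⟩
  ι (y + sum Y) -ℚ ι (suc (length Y)) *ℚ d             ∎
  where
  open ≡-Reasoning
  regroup : ∀ a s l d → (a -ℚ d) +ℚ (s -ℚ l *ℚ d) ≡ (a +ℚ s) -ℚ (1ℚ +ℚ l) *ℚ d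
  regroup = solve 4 (λ a s l d → (a :- d) :+ (s :- l :* d) := (a :+ s) :- (con 1ℚ :+ l) :* d) refl

letters : ∀ {m n} → Vec (Fin m) n → List ℕ
letters [] = []
letters (a ∷ p) = toℕ a ∷ letters p

letters-< : ∀ {m n} (p : Vec (Fin m) n) → All (_< m) (letters p)
letters-< [] = []
letters-< (a ∷ p) = toℕ<n a ∷ letters-< p

length-letters : ∀ {m n} (p : Vec (Fin m) n) → length (letters p) ≡ n
length-letters [] = refl
length-letters (a ∷ p) = cong suc (length-letters p)

countBelow-letters : ∀ {m n} i (p : Vec (Fin m) n) → countBelow i p ≡ count< i (letters p)
countBelow-letters i [] = refl
countBelow-letters i (a ∷ p) with toℕ a <? i
... | yes _ = cong suc (countBelow-letters i p)
... | no _ = countBelow-letters i p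

module Realisation (m' : ℕ) (c : ℚ) where
  open IntegerModel m' using (m; hop; run)

  -- After t letters the chip at height y sits at y − t − c in V^m.
  position : ℕ → ℕ → ℚ
  position t y = ι y -ℚ (c +ℚ ι t)

  realise : ℕ → List ℕ → List ℚ
  realise t = map (position t)

  position-mono : ∀ t {x y} → x ≤ y → position t x ≤ℚ position t y
  position-mono t x≤y = ℚ.+-monoˡ-≤ (ℚ.- (c +ℚ ι t)) (ι-mono x≤y)

  position-suc : ∀ t y → position t y -ℚ 1ℚ ≡ position (suc t) y
  position-suc t y =
    trans (regroup (ι y) c (ι t)) (cong (λ s → ι y -ℚ (c +ℚ s)) (trans (ι-+ t 1) (cong ι (+-comm t 1))))
    where
    regroup : ∀ a c s → a -ℚ (c +ℚ s) -ℚ 1ℚ ≡ a -ℚ (c +ℚ (s +ℚ 1ℚ))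
    regroup = solve 3 (λ a c s → a :- (c :+ s) :- con 1ℚ := a :- (c :+ (s :+ con 1ℚ))) refl

  position-+ : ∀ t y s → position t (y + s) ≡ position t y +ℚ ι s
  position-+ t y s = trans (cong (_-ℚ (c +ℚ ι t)) (sym (ι-+ y s))) (regroup (ι y) (ι s) c (ι t))
    where
    regroup : ∀ a b c s → (a +ℚ b) -ℚ (c +ℚ s) ≡ (a -ℚ (c +ℚ s)) +ℚ b
    regroup = solve 4 (λ a b c s → (a :+ b) :- (c :+ s) := (a :- (c :+ s)) :+ b) refl

  position-shift : ∀ t s y → position (t + s) (y + s) ≡ position t y
  position-shift t s y =
    trans (cong₂ (λ a b → a -ℚ (c +ℚ b)) (sym (ι-+ y s)) (sym (ι-+ t s))) (regroup (ι y) (ι s) c (ι t))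
    where
    regroup : ∀ a b c s → (a +ℚ b) -ℚ (c +ℚ (s +ℚ b)) ≡ a -ℚ (c +ℚ s)
    regroup = solve 4 (λ a b c s → (a :+ b) :- (c :+ (s :+ b)) := a :- (c :+ s)) refl

  actLetter-realise : ∀ a t Y → actLetter m a (realise t Y) ≡ realise (suc t) (hop (toℕ a) Y)
  actLetter-realise a t Y = begin
    ℚSort.sort (addAt (toℕ a) (ι m) (map (_-ℚ 1ℚ) (map (position t) Y)))
      ≡⟨ cong (λ Z → ℚSort.sort (addAt (toℕ a) (ι m) Z)) (trans (sym (map-∘ Y)) (map-cong (position-suc t) Y)) ⟩
    ℚSort.sort (addAt (toℕ a) (ι m) (map (position (suc t)) Y))
      ≡⟨ cong ℚSort.sort (addAt-map (position (suc t)) (λ y → position-+ (suc t) y m) (toℕ a) Y) ⟩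
    ℚSort.sort (map (position (suc t)) (addAtℕ (toℕ a) m Y))
      ≡⟨ sort-map (position (suc t)) (position-mono (suc t)) (addAtℕ (toℕ a) m Y) ⟩
    map (position (suc t)) (hop (toℕ a) Y) ∎
    where open ≡-Reasoning

  actWord-realise : ∀ {n} (p : Vec (Fin m) n) t Y →
                    actWord p (realise t Y) ≡ realise (t + n) (run (letters p) Y)
  actWord-realise [] t Y = cong (λ s → realise s Y) (sym (+-identityʳ t))
  actWord-realise {suc n} (a ∷ p) t Y = begin
    actWord p (actLetter m a (realise t Y))                  ≡⟨ cong (actWord p) (actLetter-realise a t Y) ⟩
    actWord p (realise (suc t) (hop (toℕ a) Y))              ≡⟨ actWord-realise p (suc t) (hop (toℕ a) Y) ⟩
    realise (suc t + n) Z                                    ≡⟨ cong (λ s → realise s Z) (+-suc t n) ⟨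
    realise (t + suc n) Z                                    ∎
    where
    open ≡-Reasoning
    Z : List ℕ
    Z = run (letters (a ∷ p)) Y

  realise-shift : ∀ t s Y → realise (t + s) (map (_+ s) Y) ≡ realise t Y
  realise-shift t s Y = trans (sym (map-∘ Y)) (map-cong (λ y → position-shift t s y) Y)

centre : ℕ → List ℕ → ℚ
centre m' Y = ι (sum Y) *ℚ 1/ ι (suc m')
  where instance _ = ι-suc-nonZero m'

InV-realise-centre : ∀ m' {Y} → IntegerModel.Config m' Y → InV (suc m') (Realisation.realise m' (centre m' Y) 0 Y)
InV-realise-centre m' {Y} cY = length-realise , sum-realise , sorted-realise
  where
  open IntegerModel m' using (m; sorted; length≡m)
  open Realisation m' (centre m' Y)
  instance _ = ι-suc-nonZero m'
  length-realise : length (realise 0 Y) ≡ m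
  length-realise = trans (length-map (position 0) Y) (length≡m cY)
  sorted-realise : SortedBy ℚ≤-totalOrder (realise 0 Y)
  sorted-realise = Sorted.map⁺ ≤-totalOrder ℚ≤-totalOrder (position-mono 0) (sorted cY)
  sum-realise : sumℚ (realise 0 Y) ≡ 0ℚ
  sum-realise = begin
    sumℚ (realise 0 Y)                       ≡⟨ sumℚ-map-ι (centre m' Y +ℚ 0ℚ) Y ⟩
    S -ℚ ι (length Y) *ℚ (S *ℚ 1/ M +ℚ 0ℚ)  ≡⟨ cong (λ l → S -ℚ ι l *ℚ (S *ℚ 1/ M +ℚ 0ℚ)) (length≡m cY) ⟩
    S -ℚ M *ℚ (S *ℚ 1/ M +ℚ 0ℚ)             ≡⟨ regroup S M (1/ M) ⟩
    S -ℚ S *ℚ (M *ℚ 1/ M)                   ≡⟨ cong (λ u → S -ℚ S *ℚ u) (ℚ.*-inverseʳ M) ⟩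
    S -ℚ S *ℚ 1ℚ                            ≡⟨ cancel S ⟩
    0ℚ                                       ∎
    where
    open ≡-Reasoning
    S M : ℚ
    S = ι (sum Y)
    M = ι m
    regroup : ∀ s a b → s -ℚ a *ℚ (s *ℚ b +ℚ 0ℚ) ≡ s -ℚ s *ℚ (a *ℚ b)
    regroup = solve 3 (λ s a b → s :- a :* (s :* b :+ con 0ℚ) := s :- s :* (a :* b)) refl
    cancel : ∀ s → s -ℚ s *ℚ 1ℚ ≡ 0ℚ
    cancel = solve 1 (λ s → s :- s :* con 1ℚ := con 0ℚ) refl

IsPW⇒Parking : ∀ {m' n'} (p : Vec (Fin (suc m')) (suc n')) → IsPW (suc m') (suc n') p →
               IntegerModel.Staircase.Parking m' n' (letters p)
IsPW⇒Parking p isPW zero _ = z≤n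
IsPW⇒Parking {m'} {n'} p isPW (suc i) i≤m =
  subst (λ k → suc i * suc n' ≤ suc m' * k) (countBelow-letters (suc i) p) (isPW (suc i) (s≤s z≤n) i≤m)

lemma3p2 : (m n : ℕ) → 1 ≤ m → 1 ≤ n → (p : Vec (Fin m) n) →
    IsPW m n p → HasNoTouchPoint m n p →
    Σ (List ℚ) (λ x → InV m x × actWord p x ≡ x)
lemma3p2 (suc m') (suc n') _ _ p isPW _ = realise 0 Y , InV-realise-centre m' config-Y , (begin
  actWord p (realise 0 Y)         ≡⟨ actWord-realise p 0 Y ⟩
  realise n (run (letters p) Y)   ≡⟨ cong (realise n) run-Y ⟩
  realise (0 + n) (map (_+ n) Y)  ≡⟨ realise-shift 0 n Y ⟩
  realise 0 Y                     ∎)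
  where
  open IntegerModel m'
  open Staircase n'
  open Iteration (letters-< p) (length-letters p) (IsPW⇒Parking p isPW)
  Y : List ℕ
  Y = proj₁ fixed-point
  config-Y : Config Y
  config-Y = proj₁ (proj₂ fixed-point)
  run-Y : run (letters p) Y ≡ map (_+ n) Y
  run-Y = proj₂ (proj₂ fixed-point)
  open Realisation m' (centre m' Y)
  open ≡-Reasoning
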